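{- Let $n \geq 3$ and let $S$ be a $4$-cap free, $n$-cup free configuration. If $S$ contains a pair of interweaved laced $(n-1)$-cups, then $S$ contains a (weak) $(3, n-1)$-gon.
   Context: A configuration is a finite set $S$ with a linear order $<$, together with an arbitrary assignment, to each $3$-element subset, of "cap" or "cup". Points $x_1 < \cdots < x_m$ form an $m$-cup (resp. $m$-cap) if every consecutive triple $x_{i-1}x_ix_{i+1}$ is labeled cup (resp. cap); 1- and 2-element sets count as both; it is a cup from $x_1$ (starting point) to $x_m$ (ending point), and its size is $m$. Two cups $C_1, C_2$ from $p$ to $r$ and from $q$ to $s$ respectively are interweaved if $p < q \leq r < s$. An $(n-1)$-cup $C$ from $p$ to $q$ is laced if there exist a cup $C_p$ ending with $p$ and a cup $C_q$ starting with $q$ with $|C_p| + |C_q| = n-1$. A (weak) $(a,b)$-gon is a pair consisting of an $a$-cap and a $b$-cup with the same two endpoints (other vertices may be shared). -}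

module Defs where

open import Data.Nat using (ℕ; _+_; _∸_; _≥_)
open import Data.Fin using (Fin; _<_; _≤_)
open import Data.List using (List; []; _∷_; length; head; last)
open import Data.List.Relation.Unary.Linked using (Linked)
open import Data.Maybe using (just)
open import Data.Product using (Σ; _×_; ∃; ∃-syntax)
open import Relation.Binary.PropositionalEquality using (_≡_)
open import Relation.Nullary using (¬_)
open import Data.Unit using (⊤)

data Label : Set where
  cup cap : Label

-- A configuration on N points: the points are Fin N with the usual order,
-- and χ i j k is the label of the 3-subset {i,j,k}, read only for i < j < k.
Labelling : ℕ → Set
Labelling N = Fin N → Fin N → Fin N → Label

ConsecTriples : ∀ {N} → (Fin N → Fin N → Fin N → Set) → List (Fin N) → Set
ConsecTriples P (x ∷ y ∷ z ∷ rest) = P x y z × ConsecTriples P (y ∷ z ∷ rest)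
ConsecTriples P _ = ⊤

IsCup : ∀ {N} → Labelling N → List (Fin N) → Set
IsCup χ xs = Linked _<_ xs × ConsecTriples (λ a b c → χ a b c ≡ cup) xs

IsCap : ∀ {N} → Labelling N → List (Fin N) → Set
IsCap χ xs = Linked _<_ xs × ConsecTriples (λ a b c → χ a b c ≡ cap) xs

CupFromTo : ∀ {N} → Labelling N → ℕ → Fin N → Fin N → Set
CupFromTo χ m p q = Σ (List _) λ xs →
  IsCup χ xs × length xs ≡ m × head xs ≡ just p × last xs ≡ just q

CapFromTo : ∀ {N} → Labelling N → ℕ → Fin N → Fin N → Set
CapFromTo χ m p q = Σ (List _) λ xs →
  IsCap χ xs × length xs ≡ m × head xs ≡ just p × last xs ≡ just q

CupFree : ∀ {N} → Labelling N → ℕ → Set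
CupFree χ m = ¬ (Σ (List _) λ xs → IsCup χ xs × length xs ≡ m)

CapFree : ∀ {N} → Labelling N → ℕ → Set
CapFree χ m = ¬ (Σ (List _) λ xs → IsCap χ xs × length xs ≡ m)

Laced : ∀ {N} → Labelling N → ℕ → Fin N → Fin N → Set
Laced χ n p q =
  Σ (List _) λ Cp → Σ (List _) λ Cq →
    IsCup χ Cp × last Cp ≡ just p ×
    IsCup χ Cq × head Cq ≡ just q ×
    length Cp + length Cq ≡ n ∸ 1

LacedCup : ∀ {N} → Labelling N → ℕ → Fin N → Fin N → Set
LacedCup χ n p q = CupFromTo χ (n ∸ 1) p q × Laced χ n p q

HasInterweavedLacedPair : ∀ {N} → Labelling N → ℕ → Set
HasInterweavedLacedPair χ n =
  ∃[ p ] ∃[ q ] ∃[ r ] ∃[ s ]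
    (p < q × q ≤ r × r < s × LacedCup χ n p r × LacedCup χ n q s)

HasGon : ∀ {N} → Labelling N → ℕ → ℕ → Set
HasGon χ a b = ∃[ x ] ∃[ y ] (CapFromTo χ a x y × CupFromTo χ b x y)

{-# OPTIONS --safe #-}
-- Since S is 4-cap free and n-cup free, every (n-1)-cup C is maximal: a point before its
-- start makes a cap with the first two points of C, a point after its end makes a cap
-- with the last two, and two caps sharing two consecutive points would form a 4-cap.
-- For cups C1 from p to r and C2 from q to s with q < r: a cap pqr or qrs closes C1 or C2
-- into a (3,n-1)-gon; otherwise the maximality facts let us insert q between the two
-- halves of the lace of C1, or r into that of C2, producing an n-cup.
-- For q = r, with c the penultimate point of C1 and d the second point of C2, cqs is a
-- cap; either C2 with q replaced by c is an (n-1)-cup closed by cqs, or cdd' is a cap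
-- (d' the third point of C2), so C1 with q replaced by d is an (n-1)-cup closed by the
-- cap pqd, since a cup pqd would prolong C2 to an n-cup.
module Submission where

open import Defs
open import Data.Nat using (ℕ; suc; s≤s; _+_; _∸_; _≥_)
open import Data.Fin using (Fin; _<_; _≟_)
open import Data.Fin.Properties using (<-trans; ≤∧≢⇒<)
open import Data.List using (List; []; _∷_; [_]; _++_; _∷ʳ_; length; head; last)
open import Data.List.Properties using (length-++; length-++-sucʳ)
open import Data.List.Relation.Unary.Linked using (Linked; []; [-]; _∷_)
open import Data.Maybe using (just)
open import Data.Product using (_,_; proj₁; ∃-syntax; _×_)
open import Data.Sum using (_⊎_; inj₁; inj₂)
open import Data.Empty using (⊥; ⊥-elim)
open import Data.Unit using (⊤; tt)
open import Relation.Binary.PropositionalEquality using (_≡_; refl; cong; trans)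
open import Relation.Nullary using (yes; no)

module _ {A : Set} where

  init : List A → List A
  init []           = []
  init (_ ∷ [])     = []
  init (x ∷ y ∷ xs) = x ∷ init (y ∷ xs)

  last-∷ʳ : ∀ xs (x : A) → last (xs ∷ʳ x) ≡ just x
  last-∷ʳ []           _ = refl
  last-∷ʳ (_ ∷ [])     _ = refl
  last-∷ʳ (_ ∷ y ∷ xs) x = last-∷ʳ (y ∷ xs) x

  length-∷ʳ : ∀ xs (x : A) → length (xs ∷ʳ x) ≡ suc (length xs)
  length-∷ʳ []       _ = refl
  length-∷ʳ (_ ∷ xs) x = cong suc (length-∷ʳ xs x)

  length-init-∷ʳ : ∀ xs {a} (x : A) → last xs ≡ just a → length (init xs ∷ʳ x) ≡ length xs
  length-init-∷ʳ (_ ∷ [])     _ _     = refl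
  length-init-∷ʳ (_ ∷ y ∷ xs) x lastA = cong suc (length-init-∷ʳ (y ∷ xs) x lastA)

  head-init-++ : ∀ xs ys {m} → length xs ≡ suc (suc m) → head (init xs ++ ys) ≡ head xs
  head-init-++ (_ ∷ _ ∷ _) _ _ = refl

cap-gon : ∀ {N} {χ : Labelling N} {m x y z} →
  x < y → y < z → χ x y z ≡ cap → CupFromTo χ m x z → HasGon χ 3 m
cap-gon {x = x} {y} {z} x<y y<z xyz C =
  x , z , (x ∷ y ∷ z ∷ [] , (x<y ∷ y<z ∷ [-] , xyz , tt) , refl , refl , refl) , C

module _ {N : ℕ} (χ : Labelling N) where

  CupAfter : List (Fin N) → Fin N → Set
  CupAfter (u ∷ a ∷ [])     b = χ u a b ≡ cup
  CupAfter (_ ∷ v ∷ w ∷ xs) b = CupAfter (v ∷ w ∷ xs) b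
  CupAfter _                _ = ⊤

  CupBefore : Fin N → List (Fin N) → Set
  CupBefore a (b ∷ c ∷ _) = χ a b c ≡ cup
  CupBefore _ _           = ⊤

  cupAfter-or-cap : ∀ xs {a} b → Linked _<_ xs → last xs ≡ just a →
    CupAfter xs b ⊎ ∃[ u ] (last (init xs) ≡ just u × u < a × χ u a b ≡ cap)
  cupAfter-or-cap (_ ∷ [])         _ _           _     = inj₁ tt
  cupAfter-or-cap (u ∷ a ∷ [])     b (u<a ∷ [-]) refl with χ u a b in uab
  ... | cup = inj₁ refl
  ... | cap = inj₂ (u , refl , u<a , uab)
  cupAfter-or-cap (_ ∷ v ∷ w ∷ xs) b (_ ∷ L)     lastA = cupAfter-or-cap (v ∷ w ∷ xs) b L lastA

  cupBefore-or-cap : ∀ a xs {b} → Linked _<_ xs → head xs ≡ just b →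
    CupBefore a xs ⊎ ∃[ c ] (b < c × χ a b c ≡ cap)
  cupBefore-or-cap _ (_ ∷ [])    _         _    = inj₁ tt
  cupBefore-or-cap a (b ∷ c ∷ _) (b<c ∷ _) refl with χ a b c in abc
  ... | cup = inj₁ refl
  ... | cap = inj₂ (c , b<c , abc)

  tail-isCup : ∀ {x} xs → IsCup χ (x ∷ xs) → IsCup χ xs
  tail-isCup []          _               = [] , tt
  tail-isCup (_ ∷ [])    _               = [-] , tt
  tail-isCup (_ ∷ _ ∷ _) (_ ∷ L , _ , T) = L , T

  init-isCup : ∀ xs → IsCup χ xs → IsCup χ (init xs)
  init-isCup []                   _                   = [] , tt
  init-isCup (_ ∷ [])             _                   = [] , tt
  init-isCup (_ ∷ _ ∷ [])         _                   = [-] , tt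
  init-isCup (_ ∷ _ ∷ _ ∷ [])     (x<y ∷ _ , _)       = x<y ∷ [-] , tt
  init-isCup (_ ∷ y ∷ z ∷ w ∷ xs) (x<y ∷ L , xyz , T) with init-isCup (y ∷ z ∷ w ∷ xs) (L , T)
  ... | L′ , T′ = x<y ∷ L′ , xyz , T′

  ∷-isCup : ∀ {a b} xs → a < b → CupBefore a (b ∷ xs) → IsCup χ (b ∷ xs) → IsCup χ (a ∷ b ∷ xs)
  ∷-isCup []      a<b _   _       = a<b ∷ [-] , tt
  ∷-isCup (_ ∷ _) a<b abc (L , T) = a<b ∷ L , abc , T

  ++-isCup : ∀ xs ys {a b} → IsCup χ xs → IsCup χ ys → last xs ≡ just a → head ys ≡ just b →
    a < b → CupAfter xs b → CupBefore a ys → IsCup χ (xs ++ ys)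
  ++-isCup (_ ∷ [])         (_ ∷ ys) _ cupB refl refl a<b _ before = ∷-isCup ys a<b before cupB
  ++-isCup (_ ∷ y ∷ [])     (_ ∷ ys) (x<y ∷ [-] , _) cupB refl refl y<b xyb before =
    ∷-isCup _ x<y xyb (++-isCup [ y ] (_ ∷ ys) ([-] , tt) cupB refl refl y<b tt before)
  ++-isCup (_ ∷ y ∷ z ∷ xs) ys (x<y ∷ L , xyz , T) cupB lastA headB a<b after before =
    ∷-isCup _ x<y xyz (++-isCup (y ∷ z ∷ xs) ys (L , T) cupB lastA headB a<b after before)

  ∷ʳ-isCup : ∀ xs {a b} → IsCup χ xs → last xs ≡ just a → a < b → CupAfter xs b → IsCup χ (xs ∷ʳ b)
  ∷ʳ-isCup xs cupA lastA a<b after = ++-isCup xs [ _ ] cupA ([-] , tt) lastA refl a<b after tt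

  insert-isCup : ∀ xs {a} x ys {b} → IsCup χ xs → last xs ≡ just a → IsCup χ ys → head ys ≡ just b →
    a < x → x < b → CupAfter xs x → χ a x b ≡ cup → CupBefore x ys → IsCup χ (xs ++ x ∷ ys)
  insert-isCup xs x (_ ∷ ys) cupA lastA cupB refl a<x x<b after axb before =
    ++-isCup xs (x ∷ _ ∷ ys) cupA (++-isCup [ x ] (_ ∷ ys) ([-] , tt) cupB refl refl x<b tt before)
      lastA refl a<x after axb

module Saturated {N : ℕ} (χ : Labelling N) (no-4-cap : CapFree χ 4)
                 (k : ℕ) (no-long-cup : CupFree χ (3 + k)) where

  ¬chained-caps : ∀ {a b c d} → a < b → b < c → c < d → χ a b c ≡ cap → χ b c d ≡ cap → ⊥
  ¬chained-caps a<b b<c c<d abc bcd =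
    no-4-cap (_ ∷ _ ∷ _ ∷ _ ∷ [] , (a<b ∷ b<c ∷ c<d ∷ [-] , abc , bcd , tt) , refl)

  cupAfter-of-cap : ∀ xs {a b c} → Linked _<_ xs → last xs ≡ just a →
    a < b → b < c → χ a b c ≡ cap → CupAfter χ xs b
  cupAfter-of-cap xs L lastA a<b b<c abc with cupAfter-or-cap χ xs _ L lastA
  ... | inj₁ after               = after
  ... | inj₂ (_ , _ , u<a , uab) = ⊥-elim (¬chained-caps u<a a<b b<c uab abc)

  cupBefore-of-cap : ∀ ys {x a b} → Linked _<_ ys → head ys ≡ just b →
    x < a → a < b → χ x a b ≡ cap → CupBefore χ a ys
  cupBefore-of-cap ys L headB x<a a<b xab with cupBefore-or-cap χ _ ys L headB
  ... | inj₁ before          = before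
  ... | inj₂ (_ , b<c , abc) = ⊥-elim (¬chained-caps x<a a<b b<c xab abc)

  cap-after-end : ∀ {xs a b} → IsCup χ xs → length xs ≡ 2 + k → last xs ≡ just a → a < b →
    ∃[ u ] (last (init xs) ≡ just u × u < a × χ u a b ≡ cap)
  cap-after-end {xs} {b = b} cupA len lastA a<b with cupAfter-or-cap χ xs b (proj₁ cupA) lastA
  ... | inj₂ cap-end = cap-end
  ... | inj₁ after   = ⊥-elim (no-long-cup (xs ∷ʳ b , ∷ʳ-isCup χ xs cupA lastA a<b after ,
                                            trans (length-∷ʳ xs b) (cong suc len)))

  cap-before-start : ∀ {a d y} xs → IsCup χ (a ∷ d ∷ xs) → length (a ∷ d ∷ xs) ≡ 2 + k →
    y < a → χ y a d ≡ cap
  cap-before-start {a} {d} {y} xs cupC len y<a with χ y a d in yad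
  ... | cap = refl
  ... | cup = ⊥-elim (no-long-cup (y ∷ a ∷ d ∷ xs , ∷-isCup χ (d ∷ xs) y<a yad cupC , cong suc len))

  no-cap-after-end : ∀ {xs a y z} → IsCup χ xs → length xs ≡ 2 + k → last xs ≡ just a →
    a < y → y < z → χ a y z ≡ cap → ⊥
  no-cap-after-end cupC len lastC a<y y<z ayz with cap-after-end cupC len lastC a<y
  ... | _ , _ , u<a , uay = ¬chained-caps u<a a<y y<z uay ayz

  no-cap-before-start : ∀ {xs a x y} → IsCup χ xs → length xs ≡ 2 + k → head xs ≡ just a →
    x < y → y < a → χ x y a ≡ cap → ⊥
  no-cap-before-start {[]}         _                   _  ()
  no-cap-before-start {_ ∷ []}     _                   () _
  no-cap-before-start {_ ∷ _ ∷ xs} cupC@(a<d ∷ _ , _) len refl x<y y<a xya =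
    ¬chained-caps x<y y<a a<d xya (cap-before-start xs cupC len y<a)

  cupAfter-cupStart : ∀ xs {p q s} → Linked _<_ xs → last xs ≡ just p → p < q →
    CupFromTo χ (2 + k) q s → CupAfter χ xs q
  cupAfter-cupStart xs L lastA p<q (_ , cupC , len , headC , _) with cupAfter-or-cap χ xs _ L lastA
  ... | inj₁ after               = after
  ... | inj₂ (_ , _ , u<p , upq) = ⊥-elim (no-cap-before-start cupC len headC u<p p<q upq)

  cupBefore-cupEnd : ∀ ys {p r s} → Linked _<_ ys → head ys ≡ just s → r < s →
    CupFromTo χ (2 + k) p r → CupBefore χ r ys
  cupBefore-cupEnd ys L headB r<s (_ , cupC , len , _ , lastC) with cupBefore-or-cap χ _ ys L headB
  ... | inj₁ before          = before
  ... | inj₂ (_ , s<c , rsc) = ⊥-elim (no-cap-after-end cupC len lastC r<s s<c rsc)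

  no-insertion : ∀ {xs ys a x b} → IsCup χ xs → last xs ≡ just a → IsCup χ ys → head ys ≡ just b →
    length xs + length ys ≡ 2 + k → a < x → x < b →
    CupAfter χ xs x → χ a x b ≡ cup → CupBefore χ x ys → ⊥
  no-insertion {xs} {ys} {x = x} cupA lastA cupB headB len a<x x<b after axb before =
    no-long-cup (xs ++ x ∷ ys ,
                 insert-isCup χ xs x ys cupA lastA cupB headB a<x x<b after axb before ,
                 trans (length-++-sucʳ xs x ys) (cong suc (trans (length-++ xs) len)))

  strict-interweaving : ∀ {p q r s} → p < q → q < r → r < s →
    LacedCup χ (3 + k) p r → LacedCup χ (3 + k) q s → HasGon χ 3 (2 + k)
  strict-interweaving {p} {q} {r} {s} p<q q<r r<s
    (C₁ , A₁ , B₁ , cupA₁ , lastA₁ , cupB₁ , headB₁ , len₁)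
    (C₂ , A₂ , B₂ , cupA₂ , lastA₂ , cupB₂ , headB₂ , len₂)
    with χ p q r in pqr | χ q r s in qrs
  ... | cap | _   = cap-gon p<q q<r pqr C₁
  ... | cup | cap = cap-gon q<r r<s qrs C₂
  ... | cup | cup with cupAfter-or-cap χ A₂ r (proj₁ cupA₂) lastA₂
  ... | inj₁ after = ⊥-elim (no-insertion cupA₂ lastA₂ cupB₂ headB₂ len₂ q<r r<s after qrs
                               (cupBefore-cupEnd B₂ (proj₁ cupB₂) headB₂ r<s C₁))
  ... | inj₂ (_ , _ , u<q , uqr) =
    ⊥-elim (no-insertion cupA₁ lastA₁ cupB₁ headB₁ len₁ p<q q<r
              (cupAfter-cupStart A₁ (proj₁ cupA₁) lastA₁ p<q C₂) pqr
              (cupBefore-of-cap B₁ (proj₁ cupB₁) headB₁ u<q q<r uqr))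

  touching-interweaving : ∀ {p q s} → p < q → q < s →
    CupFromTo χ (2 + k) p q → CupFromTo χ (2 + k) q s → HasGon χ 3 (2 + k)
  touching-interweaving _ _ _ ([]     , _ , _  , () , _)
  touching-interweaving _ _ _ (_ ∷ [] , _ , () , _)
  touching-interweaving {p} {q} p<q q<s (C₁ , cup₁ , len₁ , head₁ , last₁)
                        (_ ∷ d ∷ R , cup₂@(q<d ∷ L , _) , len₂ , refl , last₂)
    with cap-after-end cup₁ len₁ last₁ q<s
  ... | c , lastInit₁ , c<q , cqs with cupBefore-or-cap χ c (d ∷ R) L refl
  ... | inj₁ cdR = cap-gon c<q q<s cqs
        (c ∷ d ∷ R , ∷-isCup χ R (<-trans c<q q<d) cdR (tail-isCup χ (d ∷ R) cup₂) , len₂ , refl , last₂)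
  ... | inj₂ (_ , d<e , cde) with χ p q d in pqd
  ... | cup = ⊥-elim (no-long-cup (p ∷ q ∷ d ∷ R , ∷-isCup χ (d ∷ R) p<q pqd cup₂ , cong suc len₂))
  ... | cap = cap-gon p<q q<d pqd
        (init C₁ ∷ʳ d ,
         ∷ʳ-isCup χ (init C₁) (init-isCup χ C₁ cup₁) lastInit₁ c<d
           (cupAfter-of-cap (init C₁) (proj₁ (init-isCup χ C₁ cup₁)) lastInit₁ c<d d<e cde) ,
         trans (length-init-∷ʳ C₁ d last₁) len₁ ,
         trans (head-init-++ C₁ [ d ] len₁) head₁ ,
         last-∷ʳ (init C₁) d)
    where
    c<d : c < d
    c<d = <-trans c<q q<d

  interweaving-gon : HasInterweavedLacedPair χ (3 + k) → HasGon χ 3 (2 + k)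
  interweaving-gon (_ , q , r , _ , p<q , q≤r , r<s , C₁ , C₂) with q ≟ r
  ... | yes refl = touching-interweaving p<q r<s (proj₁ C₁) (proj₁ C₂)
  ... | no q≢r   = strict-interweaving p<q (≤∧≢⇒< q≤r q≢r) r<s C₁ C₂

lemma5p2 : (n N : ℕ) → n ≥ 3 → (χ : Labelling N) →
    CapFree χ 4 → CupFree χ n →
    HasInterweavedLacedPair χ n → HasGon χ 3 (n ∸ 1)
lemma5p2 (suc (suc (suc k))) _ (s≤s (s≤s (s≤s _))) χ no-4-cap no-n-cup =
  Saturated.interweaving-gon χ no-4-cap k no-n-cup
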